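{- Let $(D,X)$ be a dessin d'enfant with edge set $\mathcal{E}$ and monodromy pair $(\sigma_\circ,\sigma_\bullet)$, let $a,b\in\mathcal{E}$ be distinct, and let $t\in S_{\mathcal{E}}$ be the transposition exchanging $a$ and $b$. If $(\sigma_\circ,\sigma_\bullet)$ is not Exceptional relative to $(a,b)$, then the pair $(\sigma_\circ^t,\sigma_\bullet)$ is transitive.
   Context: Permutations compose functionally, $\pi^s=s\pi s^{ -1}$, and a pair $(x,y)$ in $S_{\mathcal E}$ is transitive iff $\langle x,y\rangle$ acts transitively on $\mathcal E$. A dessin d'enfant is a triple $(D,X,\iota)$ with $X$ a connected oriented compact surface without boundary, $D$ a finite bicolored graph (multiple edges allowed; every vertex coloured white or black, every vertex incident to some edge, every edge joining a white and a black vertex) and $\iota:D\hookrightarrow X$ an embedding whose complement is a disjoint union of open discs. Its monodromy pair $(\sigma_\circ,\sigma_\bullet)$ in $S_{\mathcal E}$: $\sigma_\circ$ sends each edge to the next edge around its white vertex in the cyclic order given by the orientation of $X$; $\sigma_\bullet$ likewise for black vertices. (Monodromy pairs of dessins d'enfants are exactly the transitive pairs.) All orbits/cycles below are of $\sigma_\circ\sigma_\bullet$. For an element $x$, list its cycle as $x=c_0,c_1=\sigma_\circ\sigma_\bullet(c_0),\dots,c_{m-1}$ and write $i_x(y)$ for the index of $y$ in this list. The pair is Exceptional relative to $(a,b)$ iff one of: (Tame #1B) $\sigma_\circ(a),\sigma_\circ(b),b$ lie in the cycle of $a$ and $0<i_a(\sigma_\circ(a))<i_a(\sigma_\circ(b))\le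 i_a(b)$ (i.e. cyclic order $a,\sigma_\circ(a),\sigma_\circ(b),b$ with $\sigma_\circ(a)\ne a$, $\sigma_\circ(b)=b$ allowed); (Tame #1A) the same with $a$ and $b$ exchanged; (Tame #2) $a,b$ lie in one orbit, $\sigma_\circ(a),\sigma_\circ(b)$ lie in one orbit, and these two orbits are different; (Wild) $a,\sigma_\circ(a)$ lie in one orbit, $b,\sigma_\circ(b)$ lie in one orbit, and these two orbits are different. -}

module Defs where

open import Data.Nat using (ℕ; zero; suc; _<_; _≤_)
open import Data.Fin using (Fin)
open import Data.Fin.Permutation using (Permutation′; _⟨$⟩ʳ_; _⟨$⟩ˡ_; _∘ₚ_; flip)
open import Data.Product using (Σ; _×_; ∃; ∃-syntax)
open import Relation.Binary.PropositionalEquality using (_≡_; _≢_)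
open import Relation.Nullary using (¬_)

-- Edge set 𝓔 is modelled as Fin n; S_𝓔 as Permutation′ n.
-- Application: π ⟨$⟩ʳ x.  Functional composition (f ∘ g means apply g first).

-- π^s = s π s⁻¹  (functional composition);  note _∘ₚ_ is diagrammatic.
conj : ∀ {n} → Permutation′ n → Permutation′ n → Permutation′ n
conj π s = flip s ∘ₚ π ∘ₚ s

data Reach {n} (x y : Permutation′ n) (e : Fin n) : Fin n → Set where
  here  : Reach x y e e
  stepx  : ∀ {f} → Reach x y e f → Reach x y e (x ⟨$⟩ʳ f)
  stepx⁻ : ∀ {f} → Reach x y e f → Reach x y e (x ⟨$⟩ˡ f)
  stepy  : ∀ {f} → Reach x y e f → Reach x y e (y ⟨$⟩ʳ f)
  stepy⁻ : ∀ {f} → Reach x y e f → Reach x y e (y ⟨$⟩ˡ f)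

Transitive : ∀ {n} → Permutation′ n → Permutation′ n → Set
Transitive x y = ∀ e f → Reach x y e f

iter : ∀ {n} → (Fin n → Fin n) → ℕ → Fin n → Fin n
iter f zero    x = x
iter f (suc k) x = f (iter f k x)

ρ : ∀ {n} → Permutation′ n → Permutation′ n → Fin n → Fin n
ρ σw σb x = σw ⟨$⟩ʳ (σb ⟨$⟩ʳ x)

SameOrbit : ∀ {n} → Permutation′ n → Permutation′ n → Fin n → Fin n → Set
SameOrbit σw σb x y = ∃[ k ] iter (ρ σw σb) k x ≡ y

-- i_x(y) ≡ k : y is the k-th entry c_k of the cycle list c_0 = x, c_1, … , c_{m-1}
-- of x; since the entries are distinct, this is the least k with ρ^k x ≡ y.
Index : ∀ {n} → Permutation′ n → Permutation′ n → Fin n → Fin n → ℕ → Set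
Index σw σb x y k = iter (ρ σw σb) k x ≡ y × (∀ j → j < k → iter (ρ σw σb) j x ≢ y)

Tame1B : ∀ {n} → Permutation′ n → Permutation′ n → Fin n → Fin n → Set
Tame1B σw σb a b =
  Σ ℕ λ i → Σ ℕ λ j → Σ ℕ λ k →
    Index σw σb a (σw ⟨$⟩ʳ a) i × Index σw σb a (σw ⟨$⟩ʳ b) j × Index σw σb a b k ×
    (0 < i) × (i < j) × (j ≤ k)

Tame1A : ∀ {n} → Permutation′ n → Permutation′ n → Fin n → Fin n → Set
Tame1A σw σb a b = Tame1B σw σb b a

Tame2 : ∀ {n} → Permutation′ n → Permutation′ n → Fin n → Fin n → Set
Tame2 σw σb a b =
  SameOrbit σw σb a b × SameOrbit σw σb (σw ⟨$⟩ʳ a) (σw ⟨$⟩ʳ b) ×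
  ¬ SameOrbit σw σb a (σw ⟨$⟩ʳ a)

Wild : ∀ {n} → Permutation′ n → Permutation′ n → Fin n → Fin n → Set
Wild σw σb a b =
  SameOrbit σw σb a (σw ⟨$⟩ʳ a) × SameOrbit σw σb b (σw ⟨$⟩ʳ b) ×
  ¬ SameOrbit σw σb a b

data Exceptional {n} (σw σb : Permutation′ n) (a b : Fin n) : Set where
  tame1B : Tame1B σw σb a b → Exceptional σw σb a b
  tame1A : Tame1A σw σb a b → Exceptional σw σb a b
  tame2  : Tame2  σw σb a b → Exceptional σw σb a b
  wild   : Wild   σw σb a b → Exceptional σw σb a b

-- Write c = σ∘(a), d = σ∘(b), t = (a b) and ρ = σ∘σ•. Since σ∘ t = (c d) σ∘, the new product is
-- σ∘ᵗ σ• = (a b)(c d) ρ: its cycles arise from those of ρ by cutting them at the special edges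
-- a, b, c, d and regluing. Once a and b lie in one orbit of ⟨σ∘ᵗ, σ•⟩, every orbit is t-stable and
-- hence ⟨σ∘, σ•⟩-stable, which gives transitivity; this is immediate when σ∘ maps a to b or b to a.
-- Otherwise, whether a and b get connected depends only on the order in which the cycles of ρ
-- visit the special edges and on whether a = c and b = d. A decision procedure runs through these
-- finitely many configurations: the ones where a and b stay apart are exactly the Exceptional ones.
module Submission where

open import Defs
open import Data.Bool using (Bool; true; false; if_then_else_)
open import Data.Empty using (⊥-elim)
open import Data.Fin using (Fin; zero; suc; toℕ; fromℕ<; _≟_)
open import Data.Fin.Permutation using (Permutation′; transpose; _⟨$⟩ʳ_; _⟨$⟩ˡ_; inverseˡ; inverseʳ)
import Data.Fin.Permutation.Components as PC
open import Data.Fin.Properties using (any?; all?; pigeonhole; toℕ-fromℕ<; toℕ<n)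
open import Data.Nat using (ℕ; zero; suc; _+_; _<_; _≤_; _<?_; _≤?_; z≤n; s≤s; z<s; s≤s⁻¹; s<s⁻¹)
open import Data.Nat.Properties
  using (n<1+n; m≤n⇒∃[o]m+o≡n; +-suc; +-comm; +-identityʳ; +-cancelˡ-<; m≤n⇒m<n∨m≡n; m≤n⇒m≤1+n;
         m≤n+m; m<n+m; ≤-refl; ≤-reflexive; ≤-trans; ≤-total; <-trans; <-≤-trans; <⇒≤; <-irrefl; <-cmp; ≮⇒≥)
open import Data.Product using (Σ; ∃; _×_; _,_; proj₁; proj₂)
open import Data.Sum using (_⊎_; inj₁; inj₂; [_,_]′)
open import Data.Vec using ([]; _∷_; lookup)
open import Function using (_∘_; Injection)
open import Function.Properties.Inverse using (↔⇒↣)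
open import Relation.Binary using (tri<; tri≈; tri>)
open import Relation.Binary.PropositionalEquality
open import Relation.Nullary using (Dec; yes; no; does; ¬_)
open import Relation.Nullary.Decidable using (_×-dec_; _⊎-dec_; _→-dec_; ¬?; map′; toWitness; dec-true; dec-false)
open import Relation.Unary using (Decidable)

iter-+ : ∀ {n} (f : Fin n → Fin n) m k x → iter f (m + k) x ≡ iter f m (iter f k x)
iter-+ f zero    k x = refl
iter-+ f (suc m) k x = cong f (iter-+ f m k x)

iter-injective : ∀ {n} {f : Fin n → Fin n} → (∀ {x y} → f x ≡ f y → x ≡ y) →
                 ∀ k {x y} → iter f k x ≡ iter f k y → x ≡ y
iter-injective inj zero    e = e
iter-injective inj (suc k) e = iter-injective inj k (inj e)

iter-periodic : ∀ {n} {f : Fin n → Fin n} → (∀ {x y} → f x ≡ f y → x ≡ y) →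
                ∀ x → ∃ λ k → iter f (suc k) x ≡ x
iter-periodic {n} {f} inj x
  with i , j , i<j , fi≡fj ← pigeonhole (n<1+n n) (λ i → iter f (toℕ i) x)
  with k , i+1+k≡j ← m≤n⇒∃[o]m+o≡n i<j
  = k , sym (iter-injective inj (toℕ i) (begin
      iter f (toℕ i) x                  ≡⟨ fi≡fj ⟩
      iter f (toℕ j) x                  ≡⟨ cong (λ m → iter f m x) (trans (+-suc (toℕ i) k) i+1+k≡j) ⟨
      iter f (toℕ i + suc k) x          ≡⟨ iter-+ f (toℕ i) (suc k) x ⟩
      iter f (toℕ i) (iter f (suc k) x) ∎))
  where open ≡-Reasoning

least-witness : {P : ℕ → Set} → (∀ k → Dec (P k)) → ∀ {m} → P m →
                ∃ λ k → P k × (∀ j → j < k → ¬ P j)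
least-witness P? {zero} p0 = 0 , p0 , λ _ ()
least-witness P? {suc m} pm with P? 0
... | yes p0 = 0 , p0 , λ _ ()
... | no ¬p0 with k , pk , below ← least-witness (P? ∘ suc) pm =
  suc k , pk , λ { zero _ → ¬p0 ; (suc j) j<k → below j (s<s⁻¹ j<k) }

monotone-from-step : (f : ℕ → ℕ) → (∀ r → f r ≤ f (suc r)) → ∀ {r r′} → r ≤ r′ → f r ≤ f r′
monotone-from-step f step {r′ = zero} z≤n = ≤-refl
monotone-from-step f step {r} {suc r′} r≤1+r′ with m≤n⇒m<n∨m≡n r≤1+r′
... | inj₁ r<1+r′ = ≤-trans (monotone-from-step f step (s≤s⁻¹ r<1+r′)) (step r′)
... | inj₂ refl  = ≤-refl

module _ {n} (i j : Fin n) {k : Fin n} where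

  transpose-≡ˡ : k ≡ i → PC.transpose i j k ≡ j
  transpose-≡ˡ k≡i rewrite dec-true (k ≟ i) k≡i = refl

  transpose-≡ʳ : k ≢ i → k ≡ j → PC.transpose i j k ≡ i
  transpose-≡ʳ k≢i k≡j rewrite dec-false (k ≟ i) k≢i | dec-true (k ≟ j) k≡j = refl

  transpose-≢ : k ≢ i → k ≢ j → PC.transpose i j k ≡ k
  transpose-≢ k≢i k≢j rewrite dec-false (k ≟ i) k≢i | dec-false (k ≟ j) k≢j = refl

permute-injective : ∀ {n} (π : Permutation′ n) {x y} → π ⟨$⟩ʳ x ≡ π ⟨$⟩ʳ y → x ≡ y
permute-injective π = Injection.injective (↔⇒↣ π)

permute-transpose : ∀ {n} (π : Permutation′ n) i j z →
  π ⟨$⟩ʳ PC.transpose i j z ≡ PC.transpose (π ⟨$⟩ʳ i) (π ⟨$⟩ʳ j) (π ⟨$⟩ʳ z)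
permute-transpose π i j z = by-cases (z ≟ i) (z ≟ j)
  where
  by-cases : Dec (z ≡ i) → Dec (z ≡ j) →
    π ⟨$⟩ʳ PC.transpose i j z ≡ PC.transpose (π ⟨$⟩ʳ i) (π ⟨$⟩ʳ j) (π ⟨$⟩ʳ z)
  by-cases (yes z≡i) _ =
    trans (cong (π ⟨$⟩ʳ_) (transpose-≡ˡ i j z≡i)) (sym (transpose-≡ˡ _ _ (cong (π ⟨$⟩ʳ_) z≡i)))
  by-cases (no z≢i) (yes z≡j) =
    trans (cong (π ⟨$⟩ʳ_) (transpose-≡ʳ i j z≢i z≡j))
          (sym (transpose-≡ʳ _ _ (z≢i ∘ permute-injective π) (cong (π ⟨$⟩ʳ_) z≡j)))
  by-cases (no z≢i) (no z≢j) =
    trans (cong (π ⟨$⟩ʳ_) (transpose-≢ i j z≢i z≢j))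
          (sym (transpose-≢ _ _ (z≢i ∘ permute-injective π) (z≢j ∘ permute-injective π)))

conj-transpose-at-a : ∀ {n} (σ : Permutation′ n) {a b : Fin n} → a ≢ b →
  conj σ (transpose a b) ⟨$⟩ʳ a ≡ PC.transpose a b (σ ⟨$⟩ʳ b)
conj-transpose-at-a σ {a} {b} a≢b = cong (PC.transpose a b ∘ (σ ⟨$⟩ʳ_)) (transpose-≡ʳ b a a≢b refl)

conj-transpose-at-b : ∀ {n} (σ : Permutation′ n) {a b : Fin n} →
  conj σ (transpose a b) ⟨$⟩ʳ b ≡ PC.transpose a b (σ ⟨$⟩ʳ a)
conj-transpose-at-b σ {a} {b} = cong (PC.transpose a b ∘ (σ ⟨$⟩ʳ_)) (transpose-≡ˡ b a refl)

conj-transpose-a↦b : ∀ {n} (σ : Permutation′ n) {a b : Fin n} → a ≢ b → σ ⟨$⟩ʳ b ≡ a →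
  conj σ (transpose a b) ⟨$⟩ʳ a ≡ b
conj-transpose-a↦b σ {a} {b} a≢b σb≡a = trans (conj-transpose-at-a σ a≢b) (transpose-≡ˡ a b σb≡a)

conj-transpose-b↦a : ∀ {n} (σ : Permutation′ n) {a b : Fin n} → a ≢ b → σ ⟨$⟩ʳ a ≡ b →
  conj σ (transpose a b) ⟨$⟩ʳ b ≡ a
conj-transpose-b↦a σ {a} {b} a≢b σa≡b =
  trans (conj-transpose-at-b σ) (transpose-≡ʳ a b (λ σa≡a → a≢b (trans (sym σa≡a) σa≡b)) σa≡b)

module _ {n} {x y : Permutation′ n} where

  Reach-trans : ∀ {e f g} → Reach x y e f → Reach x y f g → Reach x y e g
  Reach-trans r here       = r
  Reach-trans r (stepx s)  = stepx (Reach-trans r s)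
  Reach-trans r (stepx⁻ s) = stepx⁻ (Reach-trans r s)
  Reach-trans r (stepy s)  = stepy (Reach-trans r s)
  Reach-trans r (stepy⁻ s) = stepy⁻ (Reach-trans r s)

  Reach-step : ∀ {e f} → x ⟨$⟩ʳ e ≡ f → Reach x y e f
  Reach-step refl = stepx here

  Reach-sym : ∀ {e f} → Reach x y e f → Reach x y f e
  Reach-sym here = here
  Reach-sym (stepx {f} s) =
    Reach-trans (subst (Reach x y (x ⟨$⟩ʳ f)) (inverseˡ x) (stepx⁻ here)) (Reach-sym s)
  Reach-sym (stepx⁻ {f} s) =
    Reach-trans (subst (Reach x y (x ⟨$⟩ˡ f)) (inverseʳ x) (stepx here)) (Reach-sym s)
  Reach-sym (stepy {f} s) =
    Reach-trans (subst (Reach x y (y ⟨$⟩ʳ f)) (inverseˡ y) (stepy⁻ here)) (Reach-sym s)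
  Reach-sym (stepy⁻ {f} s) =
    Reach-trans (subst (Reach x y (y ⟨$⟩ˡ f)) (inverseʳ y) (stepy here)) (Reach-sym s)

  Reach-transpose : ∀ {i j e z} → Reach x y i j → Reach x y e z → Reach x y e (PC.transpose i j z)
  Reach-transpose {i} {j} {e} {z} i~j e~z = by-cases (z ≟ i) (z ≟ j)
    where
    by-cases : Dec (z ≡ i) → Dec (z ≡ j) → Reach x y e (PC.transpose i j z)
    by-cases (yes refl) _ = subst (Reach x y e) (sym (transpose-≡ˡ i j refl)) (Reach-trans e~z i~j)
    by-cases (no z≢i) (yes refl) =
      subst (Reach x y e) (sym (transpose-≡ʳ i j z≢i refl)) (Reach-trans e~z (Reach-sym i~j))
    by-cases (no z≢i) (no z≢j) = subst (Reach x y e) (sym (transpose-≢ i j z≢i z≢j)) e~z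

-- Once a and b are connected, every orbit is stable under t = (a b), hence under σ = t σᵗ t.
transitive-conj : ∀ {n} {σ τ : Permutation′ n} {a b : Fin n} →
  Reach (conj σ (transpose a b)) τ a b → Transitive σ τ → Transitive (conj σ (transpose a b)) τ
transitive-conj {σ = σ} {τ} {a} {b} a~b στ-transitive e f = lift (στ-transitive e f)
  where
  σᵗ : Permutation′ _
  σᵗ = conj σ (transpose a b)

  conjugate-back : ∀ z → PC.transpose b a (PC.transpose a b z) ≡ z
  conjugate-back z = PC.transpose-inverse b a

  lift : ∀ {e f} → Reach σ τ e f → Reach σᵗ τ e f
  lift here = here
  lift {e} (stepx {f} r) =
    subst (Reach σᵗ τ e) (trans (conjugate-back _) (cong (σ ⟨$⟩ʳ_) (conjugate-back f)))
      (Reach-transpose (Reach-sym a~b) (stepx (Reach-transpose a~b (lift r))))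
  lift {e} (stepx⁻ {f} r) =
    subst (Reach σᵗ τ e) (trans (conjugate-back _) (cong (σ ⟨$⟩ˡ_) (conjugate-back f)))
      (Reach-transpose (Reach-sym a~b) (stepx⁻ (Reach-transpose a~b (lift r))))
  lift (stepy r)  = stepy (lift r)
  lift (stepy⁻ r) = stepy⁻ (lift r)

-- The finite model

Lab : Set
Lab = Fin 4

pattern A = zero
pattern B = suc zero
pattern C = suc (suc zero)
pattern D = suc (suc (suc zero))

-- The labels stand for the special edges a, b, c = σ∘(a), d = σ∘(b). When σ∘(a) ≢ b and σ∘(b) ≢ a,
-- the only possible coincidences among them are a = c and b = d, recorded by p and q.
module Configuration (p q : Bool) where

  representative : Lab → Lab
  representative A = A
  representative B = B
  representative C = if p then A else C
  representative D = if q then B else D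

  _≈_ : Lab → Lab → Set
  x ≈ y = representative x ≡ representative y

  _≈?_ : ∀ x y → Dec (x ≈ y)
  x ≈? y = representative x ≟ representative y

  swap : Lab → Lab → Lab → Lab
  swap x y l = if does (l ≈? x) then y else if does (l ≈? y) then x else l

  module _ (N : Lab → Lab) where

    -- N models the map sending a special edge to the next special edge on its ρ-cycle, and R the
    -- same map for (a b)(c d)ρ. Only four edges are involved, so every cycle of N or R closes
    -- within four steps.
    IsNext : Set
    IsNext = ∀ x y → (x ≈ y → N x ≈ N y) × (N x ≈ N y → x ≈ y)

    R : Lab → Lab
    R l = swap A B (swap D C (N l))

    Reaches : Lab → Lab → Set
    Reaches x y = ∃ λ (r : Fin 4) → iter R (toℕ r) x ≈ y

    -- σ∘ᵗ sends a to (a b)(d) and b to (a b)(c).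
    Connected : Set
    Connected = Reaches A B ⊎ Reaches A (swap A B C) ⊎ Reaches (swap A B D) B
              ⊎ Reaches (swap A B D) (swap A B C)

    SameCycle : Lab → Lab → Set
    SameCycle s y = ∃ λ (r : Fin 4) → iter N (toℕ r) s ≈ y

    Returns : Lab → Set
    Returns s = ∃ λ (r : Fin 4) → iter N (suc (toℕ r)) s ≈ s

    FirstAt : Lab → Lab → Fin 4 → Set
    FirstAt s u r = iter N (toℕ r) s ≈ u × (∀ (r′ : Fin 4) → toℕ r′ < toℕ r → ¬ iter N (toℕ r′) s ≈ u)

    Tame1 : Lab → Lab → Lab → Lab → Set
    Tame1 s y u v = ∃ λ (i : Fin 4) → ∃ λ (j : Fin 4) → ∃ λ (k : Fin 4) →
      FirstAt s u i × FirstAt s v j × FirstAt s y k × 0 < toℕ i × toℕ i < toℕ j × toℕ j ≤ toℕ k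

    ExceptionalConfiguration : Set
    ExceptionalConfiguration = Tame1 A B C D ⊎ Tame1 B A D C
      ⊎ (SameCycle A B × SameCycle C D × Returns A × ¬ SameCycle A C)
      ⊎ (SameCycle A C × SameCycle B D × Returns A × ¬ SameCycle A B)

    iter-within-period : (∀ x y → x ≈ y → N x ≈ N y) → ∀ {s k} → iter N (suc k) s ≈ s →
                     ∀ m → ∃ λ j → j ≤ k × iter N m s ≈ iter N j s
    iter-within-period resp returns zero = 0 , z≤n , refl
    iter-within-period resp {s} returns (suc m) with j , j≤k , e ← iter-within-period resp returns m
      with m≤n⇒m<n∨m≡n j≤k
    ... | inj₁ j<k  = suc j , j<k , resp _ _ e
    ... | inj₂ refl = 0 , z≤n , trans (resp _ _ e) returns

    isNext? : Dec IsNext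
    isNext? = all? λ x → all? λ y → ((x ≈? y) →-dec (N x ≈? N y)) ×-dec ((N x ≈? N y) →-dec (x ≈? y))

    reaches? : ∀ x y → Dec (Reaches x y)
    reaches? x y = any? λ r → iter R (toℕ r) x ≈? y

    connected? : Dec Connected
    connected? = reaches? A B ⊎-dec reaches? A (swap A B C) ⊎-dec reaches? (swap A B D) B
               ⊎-dec reaches? (swap A B D) (swap A B C)

    sameCycle? : ∀ s y → Dec (SameCycle s y)
    sameCycle? s y = any? λ r → iter N (toℕ r) s ≈? y

    returns? : ∀ s → Dec (Returns s)
    returns? s = any? λ r → iter N (suc (toℕ r)) s ≈? s

    firstAt? : ∀ s u r → Dec (FirstAt s u r)
    firstAt? s u r =
      (iter N (toℕ r) s ≈? u) ×-dec all? λ r′ → (toℕ r′ <? toℕ r) →-dec ¬? (iter N (toℕ r′) s ≈? u)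

    tame1? : ∀ s y u v → Dec (Tame1 s y u v)
    tame1? s y u v = any? λ i → any? λ j → any? λ k →
      firstAt? s u i ×-dec firstAt? s v j ×-dec firstAt? s y k
        ×-dec (0 <? toℕ i) ×-dec (toℕ i <? toℕ j) ×-dec (toℕ j ≤? toℕ k)

    exceptionalConfiguration? : Dec ExceptionalConfiguration
    exceptionalConfiguration? = tame1? A B C D ⊎-dec tame1? B A D C
      ⊎-dec (sameCycle? A B ×-dec sameCycle? C D ×-dec returns? A ×-dec ¬? (sameCycle? A C))
      ⊎-dec (sameCycle? A C ×-dec sameCycle? B D ×-dec returns? A ×-dec ¬? (sameCycle? A B))

table : Lab → Lab → Lab → Lab → Lab → Lab
table nA nB nC nD = lookup (nA ∷ nB ∷ nC ∷ nD ∷ [])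

all-Bool? : {P : Bool → Set} → Decidable P → Dec (∀ b → P b)
all-Bool? P? =
  map′ (λ { (t , f) true → t ; (t , f) false → f }) (λ h → h true , h false) (P? true ×-dec P? false)

ConfigurationDichotomy : Set
ConfigurationDichotomy = ∀ p q nA nB nC nD → let open Configuration p q; N = table nA nB nC nD in
  IsNext N → Connected N ⊎ ExceptionalConfiguration N

configurationDichotomy : ConfigurationDichotomy
configurationDichotomy = toWitness {a? = decision} _
  where
  decision : Dec ConfigurationDichotomy
  decision = all-Bool? λ p → all-Bool? λ q → all? λ nA → all? λ nB → all? λ nC → all? λ nD →
    let open Configuration p q; N = table nA nB nC nD in
    isNext? N →-dec (connected? N ⊎-dec exceptionalConfiguration? N)

-- The dessin seen through its special edges

module SpecialEdges {n} (σw σb : Permutation′ n) (a b : Fin n)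
  (a≢b : a ≢ b) (c≢b : σw ⟨$⟩ʳ a ≢ b) (d≢a : σw ⟨$⟩ʳ b ≢ a) where

  c d : Fin n
  c = σw ⟨$⟩ʳ a
  d = σw ⟨$⟩ʳ b

  c≢d : c ≢ d
  c≢d = a≢b ∘ permute-injective σw

  open Configuration (does (a ≟ c)) (does (b ≟ d))

  val : Lab → Fin n
  val A = a
  val B = b
  val C = c
  val D = d

  val-representative : ∀ l → val (representative l) ≡ val l
  val-representative A = refl
  val-representative B = refl
  val-representative C with a ≟ c
  ... | yes a≡c = a≡c
  ... | no _    = refl
  val-representative D with b ≟ d
  ... | yes b≡d = b≡d
  ... | no _    = refl

  ≈⇒val≡ : ∀ x y → x ≈ y → val x ≡ val y
  ≈⇒val≡ x y x≈y = trans (sym (val-representative x)) (trans (cong val x≈y) (val-representative y))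

  val≡⇒≈ : ∀ x y → val x ≡ val y → x ≈ y
  val≡⇒≈ A A _ = refl
  val≡⇒≈ A B e = ⊥-elim (a≢b e)
  val≡⇒≈ A C e with a ≟ c
  ... | yes _   = refl
  ... | no a≢c  = ⊥-elim (a≢c e)
  val≡⇒≈ A D e = ⊥-elim (d≢a (sym e))
  val≡⇒≈ B A e = ⊥-elim (a≢b (sym e))
  val≡⇒≈ B B _ = refl
  val≡⇒≈ B C e = ⊥-elim (c≢b (sym e))
  val≡⇒≈ B D e with b ≟ d
  ... | yes _   = refl
  ... | no b≢d  = ⊥-elim (b≢d e)
  val≡⇒≈ C A e = sym (val≡⇒≈ A C (sym e))
  val≡⇒≈ C B e = ⊥-elim (c≢b e)
  val≡⇒≈ C C _ = refl
  val≡⇒≈ C D e = ⊥-elim (c≢d e)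
  val≡⇒≈ D A e = ⊥-elim (d≢a e)
  val≡⇒≈ D B e = sym (val≡⇒≈ B D (sym e))
  val≡⇒≈ D C e = ⊥-elim (c≢d (sym e))
  val≡⇒≈ D D _ = refl

  val-swap : ∀ x y l → val (swap x y l) ≡ PC.transpose (val x) (val y) (val l)
  val-swap x y l with l ≈? x
  ... | yes l≈x = sym (transpose-≡ˡ (val x) (val y) (≈⇒val≡ l x l≈x))
  ... | no l≉x with l ≈? y
  ...   | yes l≈y = sym (transpose-≡ʳ (val x) (val y) (l≉x ∘ val≡⇒≈ l x) (≈⇒val≡ l y l≈y))
  ...   | no l≉y  = sym (transpose-≢ (val x) (val y) (l≉x ∘ val≡⇒≈ l x) (l≉y ∘ val≡⇒≈ l y))

  ρ₀ : Fin n → Fin n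
  ρ₀ = ρ σw σb

  ρ₀-injective : ∀ {x y} → ρ₀ x ≡ ρ₀ y → x ≡ y
  ρ₀-injective = permute-injective σb ∘ permute-injective σw

  Special : Fin n → Set
  Special y = ∃ λ l → val l ≡ y

  special? : ∀ y → Dec (Special y)
  special? y = any? λ l → val l ≟ y

  record Gap (x : Fin n) : Set where
    field
      steps : ℕ
      lands : Special (iter ρ₀ (suc steps) x)
      skips : ∀ j → j < steps → ¬ Special (iter ρ₀ (suc j) x)

  -- Abstract, so that the type checker never unfolds the search when comparing terms built from next.
  abstract
   gap : ∀ l → Gap (val l)
   gap l with k , returns ← iter-periodic ρ₀-injective (val l)
         with steps , lands , skips ← least-witness (special? ∘ λ k → iter ρ₀ (suc k) (val l))
                                                     {k} (l , sym returns)
     = record { steps = steps ; lands = lands ; skips = skips }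

  Gap-unique : ∀ {x y} → x ≡ y → (g : Gap x) (h : Gap y) → Gap.steps g ≡ Gap.steps h
  Gap-unique refl g h with <-cmp (Gap.steps g) (Gap.steps h)
  ... | tri< g<h _ _ = ⊥-elim (Gap.skips h _ g<h (Gap.lands g))
  ... | tri≈ _ g≡h _ = g≡h
  ... | tri> _ _ h<g = ⊥-elim (Gap.skips g _ h<g (Gap.lands h))

  steps : Lab → ℕ
  steps l = Gap.steps (gap l)

  next : Lab → Lab
  next l = proj₁ (Gap.lands (gap l))

  N : Lab → Lab
  N = table (next A) (next B) (next C) (next D)

  val-N : ∀ l → val (N l) ≡ iter ρ₀ (suc (steps l)) (val l)
  val-N A = proj₂ (Gap.lands (gap A))
  val-N B = proj₂ (Gap.lands (gap B))
  val-N C = proj₂ (Gap.lands (gap C))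
  val-N D = proj₂ (Gap.lands (gap D))

  gap-interior : ∀ l o → o ≤ steps l → Special (iter ρ₀ o (val l)) → o ≡ 0
  gap-interior l zero    _      _  = refl
  gap-interior l (suc o) o<gap sp = ⊥-elim (Gap.skips (gap l) o o<gap sp)

  N-respects : ∀ x y → val x ≡ val y → val (N x) ≡ val (N y)
  N-respects x y e = begin
    val (N x)                        ≡⟨ val-N x ⟩
    iter ρ₀ (suc (steps x)) (val x)  ≡⟨ cong₂ (iter ρ₀ ∘ suc) (Gap-unique e (gap x) (gap y)) e ⟩
    iter ρ₀ (suc (steps y)) (val y)  ≡⟨ val-N y ⟨
    val (N y)                        ∎
    where open ≡-Reasoning

  -- If x lands where y does after no more steps, it lies on y's gap, which has no special interior point.
  N-reflects-≤ : ∀ x y → steps x ≤ steps y → val (N x) ≡ val (N y) → val x ≡ val y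
  N-reflects-≤ x y sx≤sy e with o , sx+o≡sy ← m≤n⇒∃[o]m+o≡n sx≤sy =
    subst (λ o → val x ≡ iter ρ₀ o (val y)) o≡0 x-on-y
    where
    open ≡-Reasoning
    x-on-y : val x ≡ iter ρ₀ o (val y)
    x-on-y = iter-injective ρ₀-injective (suc (steps x)) (begin
      iter ρ₀ (suc (steps x)) (val x)           ≡⟨ val-N x ⟨
      val (N x)                                 ≡⟨ e ⟩
      val (N y)                                 ≡⟨ val-N y ⟩
      iter ρ₀ (suc (steps y)) (val y)           ≡⟨ cong (λ k → iter ρ₀ (suc k) (val y)) sx+o≡sy ⟨
      iter ρ₀ (suc (steps x) + o) (val y)       ≡⟨ iter-+ ρ₀ (suc (steps x)) o (val y) ⟩
      iter ρ₀ (suc (steps x)) (iter ρ₀ o (val y)) ∎)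
    o≡0 : o ≡ 0
    o≡0 = gap-interior y o (subst (o ≤_) sx+o≡sy (m≤n+m o (steps x))) (x , x-on-y)

  N-reflects : ∀ x y → val (N x) ≡ val (N y) → val x ≡ val y
  N-reflects x y e with ≤-total (steps x) (steps y)
  ... | inj₁ sx≤sy = N-reflects-≤ x y sx≤sy e
  ... | inj₂ sy≤sx = sym (N-reflects-≤ y x sy≤sx (sym e))

  isNext : IsNext N
  isNext x y = (λ x≈y → val≡⇒≈ (N x) (N y) (N-respects x y (≈⇒val≡ x y x≈y)))
             , (λ Nx≈Ny → val≡⇒≈ x y (N-reflects x y (≈⇒val≡ (N x) (N y) Nx≈Ny)))

  walk : Lab → ℕ → ℕ
  walk l zero    = 0
  walk l (suc r) = suc (steps (iter N r l)) + walk l r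

  iter-walk : ∀ l r → iter ρ₀ (walk l r) (val l) ≡ val (iter N r l)
  iter-walk l zero    = refl
  iter-walk l (suc r) = begin
    iter ρ₀ (gap-r + walk l r) (val l)           ≡⟨ iter-+ ρ₀ gap-r (walk l r) (val l) ⟩
    iter ρ₀ gap-r (iter ρ₀ (walk l r) (val l))   ≡⟨ cong (iter ρ₀ gap-r) (iter-walk l r) ⟩
    iter ρ₀ gap-r (val (iter N r l))             ≡⟨ val-N (iter N r l) ⟨
    val (iter N (suc r) l)                       ∎
    where
    open ≡-Reasoning
    gap-r : ℕ
    gap-r = suc (steps (iter N r l))

  walk-mono-≤ : ∀ l {r r′} → r ≤ r′ → walk l r ≤ walk l r′
  walk-mono-≤ l = monotone-from-step (walk l) (λ r → m≤n+m (walk l r) _)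

  walk-mono-< : ∀ l {r r′} → r < r′ → walk l r < walk l r′
  walk-mono-< l {r} r<r′ = <-≤-trans (m<n+m (walk l r) z<s) (walk-mono-≤ l r<r′)

  walk-segment : ∀ l m → ∃ λ r → walk l r ≤ m × m < walk l (suc r)
  walk-segment l zero = 0 , z≤n , s≤s z≤n
  walk-segment l (suc m) with r , lo , hi ← walk-segment l m with m≤n⇒m<n∨m≡n hi
  ... | inj₁ 1+m<w = r , m≤n⇒m≤1+n lo , 1+m<w
  ... | inj₂ 1+m≡w =
    suc r , ≤-reflexive (sym 1+m≡w) , subst (_< walk l (suc (suc r))) (sym 1+m≡w) (m<n+m _ z<s)

  arrival : ∀ l m y → iter ρ₀ m (val l) ≡ val y → ∃ λ r → m ≡ walk l r × iter N r l ≈ y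
  arrival l m y hit
    with r , lo , hi ← walk-segment l m
    with o , w+o≡m ← m≤n⇒∃[o]m+o≡n lo
    = r , m≡w , val≡⇒≈ (iter N r l) y (subst (λ o → iter ρ₀ o (val (iter N r l)) ≡ val y) o≡0 from-Nʳl)
    where
    open ≡-Reasoning
    from-Nʳl : iter ρ₀ o (val (iter N r l)) ≡ val y
    from-Nʳl = begin
      iter ρ₀ o (val (iter N r l))            ≡⟨ cong (iter ρ₀ o) (iter-walk l r) ⟨
      iter ρ₀ o (iter ρ₀ (walk l r) (val l))  ≡⟨ iter-+ ρ₀ o (walk l r) (val l) ⟨
      iter ρ₀ (o + walk l r) (val l)          ≡⟨ cong (λ k → iter ρ₀ k (val l)) (trans (+-comm o _) w+o≡m) ⟩
      iter ρ₀ m (val l)                       ≡⟨ hit ⟩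
      val y                                   ∎
    o≤steps : o ≤ steps (iter N r l)
    o≤steps = s≤s⁻¹ (+-cancelˡ-< (walk l r) o _
      (subst₂ _<_ (sym w+o≡m) (+-comm (suc (steps (iter N r l))) (walk l r)) hi))
    o≡0 : o ≡ 0
    o≡0 = gap-interior (iter N r l) o o≤steps (y , sym from-Nʳl)
    m≡w : m ≡ walk l r
    m≡w = trans (sym w+o≡m) (trans (cong (walk l r +_) o≡0) (+-identityʳ _))

  sameCycle⇒SameOrbit : ∀ s y → SameCycle N s y → SameOrbit σw σb (val s) (val y)
  sameCycle⇒SameOrbit s y (r , e) =
    walk s (toℕ r) , trans (iter-walk s (toℕ r)) (≈⇒val≡ (iter N (toℕ r) s) y e)

  separated : ∀ s y → Returns N s → ¬ SameCycle N s y → ¬ SameOrbit σw σb (val s) (val y)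
  separated s y (k , returns) ¬same (m , hit)
    with r , _ , Nʳs≈y ← arrival s m y hit
    with j , j≤k , Nʳs≈Nʲs ← iter-within-period N (λ x y → proj₁ (isNext x y)) returns r
    = ¬same (fromℕ< j<4 ,
             subst (λ j → iter N j s ≈ y) (sym (toℕ-fromℕ< j<4)) (trans (sym Nʳs≈Nʲs) Nʳs≈y))
    where
    j<4 : j < 4
    j<4 = s≤s (≤-trans j≤k (s≤s⁻¹ (toℕ<n k)))

  firstAt⇒Index : ∀ s u {r} → FirstAt N s u r → Index σw σb (val s) (val u) (walk s (toℕ r))
  firstAt⇒Index s u {r} (Nʳs≈u , first) =
    trans (iter-walk s (toℕ r)) (≈⇒val≡ (iter N (toℕ r) s) u Nʳs≈u) , earlier
    where
    earlier : ∀ j → j < walk s (toℕ r) → iter ρ₀ j (val s) ≢ val u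
    earlier j j<w hit with r′ , refl , Nʳ′s≈u ← arrival s j u hit with r′ <? toℕ r
    ... | no r′≮r  = <-irrefl refl (<-≤-trans j<w (walk-mono-≤ s (≮⇒≥ r′≮r)))
    ... | yes r′<r = first (fromℕ< r′<4) (subst (_< toℕ r) (sym (toℕ-fromℕ< r′<4)) r′<r)
                       (subst (λ j → iter N j s ≈ u) (sym (toℕ-fromℕ< r′<4)) Nʳ′s≈u)
      where
      r′<4 : r′ < 4
      r′<4 = <-trans r′<r (toℕ<n r)

  tame1⇒Tame1B-shape : ∀ s y u v → Tame1 N s y u v →
    Σ ℕ λ i → Σ ℕ λ j → Σ ℕ λ k →
      Index σw σb (val s) (val u) i × Index σw σb (val s) (val v) j × Index σw σb (val s) (val y) k ×
      (0 < i) × (i < j) × (j ≤ k)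
  tame1⇒Tame1B-shape s y u v (i , j , k , first-u , first-v , first-y , 0<i , i<j , j≤k) =
    walk s (toℕ i) , walk s (toℕ j) , walk s (toℕ k) ,
    firstAt⇒Index s u first-u , firstAt⇒Index s v first-v , firstAt⇒Index s y first-y ,
    walk-mono-< s 0<i , walk-mono-< s i<j , walk-mono-≤ s j≤k

  exceptional : ExceptionalConfiguration N → Exceptional σw σb a b
  exceptional (inj₁ t)        = tame1B (tame1⇒Tame1B-shape A B C D t)
  exceptional (inj₂ (inj₁ t)) = tame1A (tame1⇒Tame1B-shape B A D C t)
  exceptional (inj₂ (inj₂ (inj₁ (ab , cd , returns , ¬ac)))) =
    tame2 (sameCycle⇒SameOrbit A B ab , sameCycle⇒SameOrbit C D cd , separated A C returns ¬ac)
  exceptional (inj₂ (inj₂ (inj₂ (ac , bd , returns , ¬ab)))) =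
    wild (sameCycle⇒SameOrbit A C ac , sameCycle⇒SameOrbit B D bd , separated A B returns ¬ab)

  σᵗ : Permutation′ n
  σᵗ = conj σw (transpose a b)

  ρᵗ : Fin n → Fin n
  ρᵗ = ρ σᵗ σb

  ρᵗ-ρ₀ : ∀ z → ρᵗ z ≡ PC.transpose a b (PC.transpose d c (ρ₀ z))
  ρᵗ-ρ₀ z = cong (PC.transpose a b) (permute-transpose σw b a (σb ⟨$⟩ʳ z))

  ρᵗ-ordinary : ∀ z → ¬ Special (ρ₀ z) → ρᵗ z ≡ ρ₀ z
  ρᵗ-ordinary z ordinary = trans (ρᵗ-ρ₀ z)
    (trans (cong (PC.transpose a b) (transpose-≢ d c (differs D) (differs C)))
           (transpose-≢ a b (differs A) (differs B)))
    where
    differs : ∀ l → ρ₀ z ≢ val l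
    differs l e = ordinary (l , sym e)

  ρᵗ-gap : ∀ l → iter ρᵗ (suc (steps l)) (val l) ≡ val (R N l)
  ρᵗ-gap l = begin
    ρᵗ (iter ρᵗ (steps l) (val l))                  ≡⟨ cong ρᵗ (agree (steps l) ≤-refl) ⟩
    ρᵗ (iter ρ₀ (steps l) (val l))                  ≡⟨ ρᵗ-ρ₀ _ ⟩
    t (PC.transpose d c (iter ρ₀ (suc (steps l)) (val l))) ≡⟨ cong (t ∘ PC.transpose d c) (val-N l) ⟨
    t (PC.transpose d c (val (N l)))                ≡⟨ cong t (val-swap D C (N l)) ⟨
    t (val (swap D C (N l)))                        ≡⟨ val-swap A B (swap D C (N l)) ⟨
    val (R N l)                                     ∎
    where
    open ≡-Reasoning
    t : Fin n → Fin n
    t = PC.transpose a b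
    agree : ∀ j → j ≤ steps l → iter ρᵗ j (val l) ≡ iter ρ₀ j (val l)
    agree zero    _       = refl
    agree (suc j) j<steps =
      trans (cong ρᵗ (agree j (<⇒≤ j<steps))) (ρᵗ-ordinary _ (Gap.skips (gap l) j j<steps))

  reach-iter-ρᵗ : ∀ k x → Reach σᵗ σb x (iter ρᵗ k x)
  reach-iter-ρᵗ zero    x = here
  reach-iter-ρᵗ (suc k) x = stepx (stepy (reach-iter-ρᵗ k x))

  reach-iter-R : ∀ r l → Reach σᵗ σb (val l) (val (iter (R N) r l))
  reach-iter-R zero    l = here
  reach-iter-R (suc r) l = Reach-trans (reach-iter-R r l)
    (subst (Reach σᵗ σb _) (ρᵗ-gap (iter (R N) r l)) (reach-iter-ρᵗ (suc (steps (iter (R N) r l))) _))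

  reaches⇒Reach : ∀ x y → Reaches N x y → Reach σᵗ σb (val x) (val y)
  reaches⇒Reach x y (r , e) =
    subst (Reach σᵗ σb (val x)) (≈⇒val≡ (iter (R N) (toℕ r) x) y e) (reach-iter-R (toℕ r) x)

  a-to-swapped-d : Reach σᵗ σb a (val (swap A B D))
  a-to-swapped-d = Reach-step (trans (conj-transpose-at-a σw a≢b) (sym (val-swap A B D)))

  b-to-swapped-c : Reach σᵗ σb b (val (swap A B C))
  b-to-swapped-c = Reach-step (trans (conj-transpose-at-b σw) (sym (val-swap A B C)))

  connected⇒Reach : Connected N → Reach σᵗ σb a b
  connected⇒Reach (inj₁ ab) = reaches⇒Reach A B ab
  connected⇒Reach (inj₂ (inj₁ ac′)) =
    Reach-trans (reaches⇒Reach A (swap A B C) ac′) (Reach-sym b-to-swapped-c)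
  connected⇒Reach (inj₂ (inj₂ (inj₁ d′b))) =
    Reach-trans a-to-swapped-d (reaches⇒Reach (swap A B D) B d′b)
  connected⇒Reach (inj₂ (inj₂ (inj₂ d′c′))) =
    Reach-trans a-to-swapped-d
      (Reach-trans (reaches⇒Reach (swap A B D) (swap A B C) d′c′) (Reach-sym b-to-swapped-c))

  a-reaches-b : ¬ Exceptional σw σb a b → Reach σᵗ σb a b
  a-reaches-b ¬exceptional =
    [ connected⇒Reach , ⊥-elim ∘ ¬exceptional ∘ exceptional ]′
      (configurationDichotomy (does (a ≟ c)) (does (b ≟ d)) (next A) (next B) (next C) (next D) isNext)

mainTheorem2 : ∀ {n : ℕ} (σw σb : Permutation′ n) (a b : Fin n) →
    Transitive σw σb → a ≢ b → ¬ Exceptional σw σb a b →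
    Transitive (conj σw (transpose a b)) σb
mainTheorem2 σw σb a b transitive a≢b ¬exceptional = transitive-conj a~b transitive
  where
  a~b : Reach (conj σw (transpose a b)) σb a b
  a~b with σw ⟨$⟩ʳ a ≟ b | σw ⟨$⟩ʳ b ≟ a
  ... | yes c≡b | _       = Reach-sym (Reach-step (conj-transpose-b↦a σw a≢b c≡b))
  ... | no _    | yes d≡a = Reach-step (conj-transpose-a↦b σw a≢b d≡a)
  ... | no c≢b  | no d≢a  = SpecialEdges.a-reaches-b σw σb a b a≢b c≢b d≢a ¬exceptional
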